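{- Let $B$ be a valid bridge diagram for $(k,n)$, corresponding to the PDS for $u$ in a reduced word $\mathbf{w}$. Let $a$ be a non-isolated wire of $B$ and let $t=u^{ -1}(a)$ be its left endpoint. If the leftmost bridge on wire $a$ is an $(a,b)$-bridge with $b>a$, then $t\le k$. If instead $b<a$, then $t>k$.
   Context: Bridge diagrams: let $\mathbf{w}=s_{i_1}\cdots s_{i_m}$ be a reduced word for $w\in S_n$ and $J\subseteq[m]$ the positions of a subexpression with product $u$. Draw $n$ horizontal wires at heights $1,\dots,n$ (numbered top to bottom). For $j=1,\dots,m$, at horizontal coordinate $m+1-j$ (so leftmost letters are rightmost), place between the two wires currently at heights $i_j$ and $i_j+1$ either a crossing (if $j\in J$; the two wires swap heights) or a bridge (if $j\notin J$; the wires do not swap). With these conventions the wire starting at height $s$ on the left ends at height $u(s)$ on the right. Wires are labeled by their right endpoints, so wire $a$ has left endpoint $u^{ -1}(a)$. An $(a,b)$-bridge is a bridge between wires $a$ and $b$. A wire is isolated if no bridge touches it. "Leftmost"/"to the right of" refer to horizontal position. Positive distinguished subexpression (PDS): with $u_{(j)}$ the ordered product of letters of $\mathbf{w}$ at positions in $J$ up to $j$ ($u_{(0)}=1$), $J$ is a PDS if $u_{(j)}\le u_{(j-1)}s_{i_j}$ and $u_{(j-1)}<u_{(j-1)}s_{i_j}$ for all $j$; for $u\le w$ it is unique. A bridge diagram is valid (for $(k,n)$) if it is the bridge diagram of the PDS for $u$ in a reduced word $\mathbf{w}$, where $u$ is anti-Grassmannian of type $(k,n)$, i.e. decreasing on $[k]$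 and on $[k+1,n]$. -}

module Defs where

open import Data.Nat as ℕ using (ℕ; zero; suc; _≤_)
open import Data.Nat.Properties using (≤-trans; n≤1+n)
open import Data.Fin as F using (Fin; toℕ; fromℕ<)
open import Data.Fin.Properties as FP using ()
open import Data.Fin.Permutation.Components using (transpose)
open import Data.Bool using (Bool; true; false)
open import Data.List as L using (List; []; _∷_; length; filter; allFin; cartesianProduct; take; drop)
open import Data.Vec as V using (Vec)
open import Data.Product using (Σ; Σ-syntax; _×_; _,_)
open import Data.Sum using (_⊎_)
open import Relation.Binary.PropositionalEquality using (_≡_)
open import Relation.Nullary using (¬_)
open import Relation.Nullary.Decidable using (_×-dec_)

-- Conventions: everything is 0-based.  Heights / wires / values are
-- Fin n = {0,…,n-1} (paper's 1,…,n shifted by one).  The paper's [k]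
-- becomes {x | toℕ x < k}.

Perm : ℕ → Set
Perm n = Fin n → Fin n

idP : ∀ {n} → Perm n
idP x = x

_∘P_ : ∀ {n} → Perm n → Perm n → Perm n
(u ∘P v) x = u (v x)

_≗P_ : ∀ {n} → Perm n → Perm n → Set
u ≗P v = ∀ x → u x ≡ v x

-- A letter s_i, i ∈ {0,…,n-2} (paper's s_{i+1}), swapping heights i, i+1.
Letter : ℕ → Set
Letter n = Σ[ i ∈ ℕ ] (suc i ℕ.< n)

lo : ∀ {n} → Letter n → Fin n
lo (i , p) = fromℕ< (≤-trans (n≤1+n (suc i)) p)

hi : ∀ {n} → Letter n → Fin n
hi (i , p) = fromℕ< p

s : ∀ {n} → Letter n → Perm n
s l = transpose (lo l) (hi l)

ℓ : ∀ {n} → Perm n → ℕ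
ℓ {n} u = length (filter (λ xy → (Data.Product.proj₁ xy FP.<? Data.Product.proj₂ xy)
                                ×-dec (u (Data.Product.proj₂ xy) FP.<? u (Data.Product.proj₁ xy)))
                       (cartesianProduct (allFin n) (allFin n)))

data _≤B_ {n : ℕ} : Perm n → Perm n → Set where
  ≤B-refl : ∀ {u w} → u ≗P w → u ≤B w
  ≤B-step : ∀ {u v w} → u ≤B v → (i j : Fin n) →
            w ≗P (v ∘P transpose i j) → ℓ v ℕ.< ℓ w → u ≤B w

_<B_ : ∀ {n} → Perm n → Perm n → Set
u <B w = u ≤B w × ¬ (u ≗P w)

prod : ∀ {n} → List (Letter n) → Perm n
prod []       = idP
prod (i ∷ is) = s i ∘P prod is

Reduced : ∀ {n} → List (Letter n) → Set
Reduced ws = ℓ (prod ws) ≡ length ws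

subProd : ∀ {n} → List (Letter n) → List Bool → Perm n
subProd (i ∷ is) (true  ∷ bs) = s i ∘P subProd is bs
subProd (i ∷ is) (false ∷ bs) = subProd is bs
subProd _        _            = idP

-- A word of length m is a Vec of letters; a subexpression J ⊆ positions
-- is its characteristic vector (true = j ∈ J).
module _ {n m : ℕ} (ws : Vec (Letter n) m) (J : Vec Bool m) where

  uPre : ℕ → Perm n
  uPre j = subProd (take j (V.toList ws)) (take j (V.toList J))

  -- positive distinguished subexpression (0-based position p is the
  -- paper's j = p+1)
  IsPDS : Set
  IsPDS = ∀ (p : Fin m) →
    let v = uPre (toℕ p) ; si = s (V.lookup ws p) in
    (uPre (suc (toℕ p)) ≤B (v ∘P si)) × (v <B (v ∘P si))

  -- Letter at position p sits at horizontal coordinate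
  -- m - p (paper: m+1-j), so the diagram is read left to right by
  -- processing positions m-1, m-2, …, 0.  leftEnds xs bs h is the left
  -- endpoint (starting height) of the wire at height h after the
  -- columns of the letters xs (which lie to the left, processed last
  -- element first): a crossing swaps the wires at heights i, i+1.
  leftEnds : List (Letter n) → List Bool → Perm n
  leftEnds (i ∷ is) (true  ∷ bs) = leftEnds is bs ∘P s i
  leftEnds (i ∷ is) (false ∷ bs) = leftEnds is bs
  leftEnds _        _            = idP

  leftEndAt : Fin m → Perm n
  leftEndAt p = leftEnds (drop (suc (toℕ p)) (V.toList ws))
                         (drop (suc (toℕ p)) (V.toList J))

  -- label (= right endpoint u(left endpoint)) of the wire at height h
  -- just before the column of position p
  labelAt : Fin m → Fin n → Fin n
  labelAt p h = subProd (V.toList ws) (V.toList J) (leftEndAt p h)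

  BridgeAt : Fin m → Fin n → Fin n → Set
  BridgeAt p a b = V.lookup J p ≡ false ×
    ((labelAt p (lo (V.lookup ws p)) ≡ a × labelAt p (hi (V.lookup ws p)) ≡ b)
     ⊎ (labelAt p (lo (V.lookup ws p)) ≡ b × labelAt p (hi (V.lookup ws p)) ≡ a))

  -- the bridge at position p is the leftmost bridge touching wire a,
  -- and it is an (a,b)-bridge.  Leftmost = smallest horizontal
  -- coordinate m - p = largest position p.
  LeftmostBridge : Fin m → Fin n → Fin n → Set
  LeftmostBridge p a b = BridgeAt p a b ×
    (∀ (q : Fin m) (c : Fin n) → toℕ p ℕ.< toℕ q → ¬ BridgeAt q a c)

AntiGrassmannian : ∀ {n} → ℕ → Perm n → Set
AntiGrassmannian {n} k u =
  (∀ (x y : Fin n) → x F.< y → toℕ y ℕ.< k → u y F.< u x) ×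
  (∀ (x y : Fin n) → x F.< y → k ≤ toℕ x → u y F.< u x)

-- Follow the diagram from the left edge up to the leftmost bridge on
-- wire a, comparing it with the wiring diagram of w (every column a
-- crossing).  Until that bridge, wire a runs exactly where the wiring
-- diagram runs the wire from t.  Every bridge column is an ascent both of
-- the labels (the subexpression is a PDS) and of the wiring diagram (the
-- word is reduced).  Hence, if at the left edge no wire starting after t
-- carries a label greater than a (true for t ∉ [k], u being decreasing
-- there), this persists for the wires the wiring diagram starts after t,
-- column by column, and at the leftmost bridge it rules out b > a.  The case
-- t ∈ [k] is the mirror image, so the argument is run once for an abstract
-- direction (the order < or >).

module Submission where

open import Defs
open import Data.Nat using (ℕ; _≤_; _<_)
open import Data.Fin as F using (Fin; toℕ)
open import Data.Bool using (Bool)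
open import Data.Vec using (Vec; toList)
open import Data.Product using (_×_)
open import Relation.Binary.PropositionalEquality using (_≡_)

open import Data.Nat as ℕ using (zero; suc; _+_; _≤‴_; ≤‴-reflexive; ≤‴-step)
import Data.Nat.Properties as ℕP
import Data.Nat.ListAction as List
import Data.Nat.ListAction.Properties as List
open import Data.Fin using (fromℕ<)
import Data.Fin.Properties as FP
import Data.Fin.Permutation as Permutation
open import Data.Bool using (true; false; if_then_else_)
open import Data.List
  using (List; []; _∷_; _++_; length; filter; cartesianProduct; allFin; take; drop; map; tabulate)
import Data.List.Properties as LP
import Data.Vec as V
open import Data.Product using (Σ-syntax; _,_; proj₁; proj₂)
open import Data.Sum using (_⊎_; inj₁; inj₂)
open import Data.Empty using (⊥-elim)
open import Function using (_∘_)
open import Level using (0ℓ)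
open import Relation.Nullary using (Dec; yes; no; does; ¬_)
open import Relation.Nullary.Decidable using (_×-dec_; dec-true; dec-false)
open import Relation.Binary using (Rel; tri<; tri≈; tri>)
open import Relation.Binary.PropositionalEquality
  using (_≢_; refl; sym; trans; cong; cong₂; subst; subst₂; module ≡-Reasoning)
open import Algebra.Properties.CommutativeMonoid.Sum ℕP.+-0-commutativeMonoid
  using (sum; sum-cong-≗; sum-replicate-zero; sum-permute; ∑-comm)

module _ {n : ℕ} (l : Letter n) where

  toℕ-lo : toℕ (lo l) ≡ proj₁ l
  toℕ-lo = FP.toℕ-fromℕ< _

  toℕ-hi : toℕ (hi l) ≡ suc (proj₁ l)
  toℕ-hi = FP.toℕ-fromℕ< _

  lo<hi : lo l F.< hi l
  lo<hi rewrite toℕ-lo | toℕ-hi = ℕP.n<1+n (proj₁ l)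

  hi≢lo : hi l ≢ lo l
  hi≢lo e = ℕP.<-irrefl (cong toℕ (sym e)) lo<hi

  above-lo : ∀ {z} → lo l F.< z → z ≢ hi l → hi l F.< z
  above-lo {z} lo<z z≢hi = ℕP.≤∧≢⇒< hi≤z (λ e → z≢hi (FP.toℕ-injective (sym e)))
    where
    hi≤z : toℕ (hi l) ℕ.≤ toℕ z
    hi≤z = subst (ℕ._≤ toℕ z) (sym toℕ-hi) (subst (λ i → suc i ℕ.≤ toℕ z) toℕ-lo lo<z)

  below-hi : ∀ {z} → z F.< hi l → z ≢ lo l → z F.< lo l
  below-hi {z} z<hi z≢lo = ℕP.≤∧≢⇒< z≤lo (λ e → z≢lo (FP.toℕ-injective e))
    where
    z≤lo : toℕ z ℕ.≤ toℕ (lo l)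
    z≤lo = subst (toℕ z ℕ.≤_) (sym toℕ-lo) (ℕP.≤-pred (subst (suc (toℕ z) ℕ.≤_) toℕ-hi z<hi))

  data HeightView (z : Fin n) : Set where
    at-lo     : z ≡ lo l → HeightView z
    at-hi     : z ≡ hi l → HeightView z
    elsewhere : z ≢ lo l → z ≢ hi l → HeightView z

  heightView : ∀ z → HeightView z
  heightView z with z FP.≟ lo l | z FP.≟ hi l
  ... | yes e | _     = at-lo e
  ... | no _  | yes e = at-hi e
  ... | no p  | no q  = elsewhere p q

  s-lo : s l (lo l) ≡ hi l
  s-lo rewrite dec-true (lo l FP.≟ lo l) refl = refl

  s-hi : s l (hi l) ≡ lo l
  s-hi rewrite dec-false (hi l FP.≟ lo l) hi≢lo | dec-true (hi l FP.≟ hi l) refl = refl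

  s-fix : ∀ z → z ≢ lo l → z ≢ hi l → s l z ≡ z
  s-fix z p q rewrite dec-false (z FP.≟ lo l) p | dec-false (z FP.≟ hi l) q = refl

  s-involutive : ∀ z → s l (s l z) ≡ z
  s-involutive z with heightView z
  ... | at-lo refl     = trans (cong (s l) s-lo) s-hi
  ... | at-hi refl     = trans (cong (s l) s-hi) s-lo
  ... | elsewhere p q  = trans (cong (s l) (s-fix z p q)) (s-fix z p q)

  s-monotone : ∀ {x y} → ¬ (x ≡ lo l × y ≡ hi l) → x F.< y → s l x F.< s l y
  s-monotone {x} {y} not-lo-hi x<y with heightView x | heightView y
  ... | at-lo refl    | at-lo refl    = ⊥-elim (ℕP.<-irrefl refl x<y)
  ... | at-lo refl    | at-hi refl    = ⊥-elim (not-lo-hi (refl , refl))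
  ... | at-lo refl    | elsewhere p q = subst₂ F._<_ (sym s-lo) (sym (s-fix y p q)) (above-lo x<y q)
  ... | at-hi refl    | at-lo refl    = ⊥-elim (ℕP.<-asym x<y lo<hi)
  ... | at-hi refl    | at-hi refl    = ⊥-elim (ℕP.<-irrefl refl x<y)
  ... | at-hi refl    | elsewhere p q = subst₂ F._<_ (sym s-hi) (sym (s-fix y p q)) (ℕP.<-trans lo<hi x<y)
  ... | elsewhere p q | at-lo refl    = subst₂ F._<_ (sym (s-fix x p q)) (sym s-lo) (ℕP.<-trans x<y lo<hi)
  ... | elsewhere p q | at-hi refl    = subst₂ F._<_ (sym (s-fix x p q)) (sym s-hi) (below-hi x<y p)
  ... | elsewhere p q | elsewhere r t = subst₂ F._<_ (sym (s-fix x p q)) (sym (s-fix y r t)) x<y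

  s-monotone⁻ : ∀ {x y} → ¬ (x ≡ hi l × y ≡ lo l) → s l x F.< s l y → x F.< y
  s-monotone⁻ {x} {y} not-hi-lo sx<sy =
    subst₂ F._<_ (s-involutive x) (s-involutive y) (s-monotone not-lo-hi sx<sy)
    where
    not-lo-hi : ¬ (s l x ≡ lo l × s l y ≡ hi l)
    not-lo-hi (sx≡lo , sy≡hi) = not-hi-lo
      ( trans (sym (s-involutive x)) (trans (cong (s l) sx≡lo) s-lo)
      , trans (sym (s-involutive y)) (trans (cong (s l) sy≡hi) s-hi))

iverson : ∀ {p} {A : Set p} → Dec A → ℕ
iverson d = if does d then 1 else 0

iverson-cong : ∀ {A B : Set} → (A → B) → (B → A) → (a? : Dec A) (b? : Dec B) → iverson a? ≡ iverson b?
iverson-cong f g (yes a) (yes b) = refl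
iverson-cong f g (yes a) (no ¬b) = ⊥-elim (¬b (f a))
iverson-cong f g (no ¬a) (yes b) = ⊥-elim (¬a (g b))
iverson-cong f g (no ¬a) (no ¬b) = refl

iverson-yes : ∀ {A : Set} → A → (a? : Dec A) → iverson a? ≡ 1
iverson-yes a (yes _) = refl
iverson-yes a (no ¬a) = ⊥-elim (¬a a)

iverson-no : ∀ {A : Set} → ¬ A → (a? : Dec A) → iverson a? ≡ 0
iverson-no ¬a (yes a) = ⊥-elim (¬a a)
iverson-no ¬a (no _)  = refl

length-filter-as-sum : ∀ {A : Set} {P : A → Set} (P? : ∀ x → Dec (P x)) (xs : List A) →
  length (filter P? xs) ≡ List.sum (map (iverson ∘ P?) xs)
length-filter-as-sum P? []       = refl
length-filter-as-sum P? (x ∷ xs) with does (P? x)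
... | true  = cong suc (length-filter-as-sum P? xs)
... | false = length-filter-as-sum P? xs

list-sum-tabulate : ∀ {A : Set} {n} (f : A → ℕ) (g : Fin n → A) →
  List.sum (map f (tabulate g)) ≡ sum (f ∘ g)
list-sum-tabulate {n = zero}  f g = refl
list-sum-tabulate {n = suc n} f g = cong (f (g F.zero) +_) (list-sum-tabulate f (g ∘ F.suc))

list-sum-cartesian : ∀ {A B : Set} {n} (f : A × B → ℕ) (g : Fin n → A) (ys : List B) →
  List.sum (map f (cartesianProduct (tabulate g) ys)) ≡ sum (λ i → List.sum (map (λ y → f (g i , y)) ys))
list-sum-cartesian {n = zero}  f g ys = refl
list-sum-cartesian {n = suc n} f g ys = begin
  List.sum (map f (map (g F.zero ,_) ys ++ rest))
    ≡⟨ cong List.sum (LP.map-++ f (map (g F.zero ,_) ys) rest) ⟩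
  List.sum (map f (map (g F.zero ,_) ys) ++ map f rest)
    ≡⟨ List.sum-++ (map f (map (g F.zero ,_) ys)) (map f rest) ⟩
  List.sum (map f (map (g F.zero ,_) ys)) + List.sum (map f rest)
    ≡⟨ cong₂ _+_ (cong List.sum (sym (LP.map-∘ ys))) (list-sum-cartesian f (g ∘ F.suc) ys) ⟩
  sum (λ i → List.sum (map (λ y → f (g i , y)) ys)) ∎
  where
  open ≡-Reasoning
  rest = cartesianProduct (tabulate (g ∘ F.suc)) ys

IsInversion : ∀ {n} → Perm n → Fin n → Fin n → Set
IsInversion u x y = x F.< y × u y F.< u x

isInversion? : ∀ {n} (u : Perm n) x y → Dec (IsInversion u x y)
isInversion? u x y = (x FP.<? y) ×-dec (u y FP.<? u x)

inversion : ∀ {n} → Perm n → Fin n → Fin n → ℕ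
inversion u x y = iverson (isInversion? u x y)

ℓ-as-sum : ∀ {n} (u : Perm n) → ℓ u ≡ sum (λ x → sum (inversion u x))
ℓ-as-sum {n} u = begin
  ℓ u
    ≡⟨ length-filter-as-sum _ (cartesianProduct (allFin n) (allFin n)) ⟩
  List.sum (map (λ xy → inversion u (proj₁ xy) (proj₂ xy)) (cartesianProduct (allFin n) (allFin n)))
    ≡⟨ list-sum-cartesian (λ xy → inversion u (proj₁ xy) (proj₂ xy)) (λ i → i) (allFin n) ⟩
  sum (λ x → List.sum (map (inversion u x) (allFin n)))
    ≡⟨ sum-cong-≗ (λ x → list-sum-tabulate (inversion u x) (λ i → i)) ⟩
  sum (λ x → sum (inversion u x)) ∎
  where open ≡-Reasoning

ℓ-cong : ∀ {n} {u w : Perm n} → u ≗P w → ℓ u ≡ ℓ w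
ℓ-cong {u = u} {w} u≗w = begin
  ℓ u                              ≡⟨ ℓ-as-sum u ⟩
  sum (λ x → sum (inversion u x))  ≡⟨ sum-cong-≗ (λ x → sum-cong-≗ (same x)) ⟩
  sum (λ x → sum (inversion w x))  ≡⟨ ℓ-as-sum w ⟨
  ℓ w                              ∎
  where
  open ≡-Reasoning
  same : ∀ x y → inversion u x y ≡ inversion w x y
  same x y rewrite u≗w x | u≗w y = refl

ℓ-reindex : ∀ {n} (u σ τ : Perm n) → (∀ x → σ (τ x) ≡ x) → (∀ x → τ (σ x) ≡ x) →
  ℓ u ≡ sum (λ x → sum (λ y → inversion u (σ x) (σ y)))
ℓ-reindex u σ τ στ τσ = begin
  ℓ u                                                  ≡⟨ ℓ-as-sum u ⟩
  sum (λ x → sum (inversion u x))                      ≡⟨ sum-permute (λ x → sum (inversion u x)) π ⟩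
  sum (λ x → sum (inversion u (σ x)))                  ≡⟨ sum-cong-≗ (λ x → sum-permute (inversion u (σ x)) π) ⟩
  sum (λ x → sum (λ y → inversion u (σ x) (σ y)))      ∎
  where
  open ≡-Reasoning
  π = Permutation.permutation σ τ στ τσ

ℓ-inverse : ∀ {n} (v w : Perm n) → (∀ x → v (w x) ≡ x) → (∀ x → w (v x) ≡ x) → ℓ v ≡ ℓ w
ℓ-inverse v w vw wv = begin
  ℓ v                                              ≡⟨ ℓ-reindex v w v wv vw ⟩
  sum (λ x → sum (λ y → inversion v (w x) (w y)))  ≡⟨ sum-cong-≗ (λ x → sum-cong-≗ (swapped x)) ⟩
  sum (λ x → sum (λ y → inversion w y x))          ≡⟨ ∑-comm (λ x y → inversion w y x) ⟩
  sum (λ y → sum (inversion w y))                  ≡⟨ ℓ-as-sum w ⟨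
  ℓ w                                              ∎
  where
  open ≡-Reasoning
  swapped : ∀ x y → inversion v (w x) (w y) ≡ inversion w y x
  swapped x y = iverson-cong
    (λ (p , q) → subst₂ F._<_ (vw y) (vw x) q , p)
    (λ (p , q) → q , subst₂ F._<_ (sym (vw y)) (sym (vw x)) p)
    (isInversion? v (w x) (w y)) (isInversion? w y x)

sum-bump : ∀ {n} (f g : Fin n → ℕ) (x₀ : Fin n) →
  (∀ x → x ≢ x₀ → g x ≡ f x) → g x₀ ≡ suc (f x₀) → sum g ≡ suc (sum f)
sum-bump {suc n} f g F.zero     agree bump =
  cong₂ _+_ bump (sum-cong-≗ (λ x → agree (F.suc x) (λ ())))
sum-bump {suc n} f g (F.suc x₀) agree bump =
  trans (cong₂ _+_ (agree F.zero (λ ()))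
                   (sum-bump (f ∘ F.suc) (g ∘ F.suc) x₀ (λ x x≢x₀ → agree (F.suc x) (x≢x₀ ∘ FP.suc-injective)) bump))
        (ℕP.+-suc (f F.zero) _)

sum²-bump : ∀ {n} (f g : Fin n → Fin n → ℕ) (x₀ y₀ : Fin n) →
  (∀ x y → ¬ (x ≡ x₀ × y ≡ y₀) → g x y ≡ f x y) → g x₀ y₀ ≡ suc (f x₀ y₀) →
  sum (λ x → sum (g x)) ≡ suc (sum (λ x → sum (f x)))
sum²-bump f g x₀ y₀ agree bump =
  sum-bump _ _ x₀ (λ x x≢x₀ → sum-cong-≗ (λ y → agree x y (x≢x₀ ∘ proj₁)))
                  (sum-bump _ _ y₀ (λ y y≢y₀ → agree x₀ y (y≢y₀ ∘ proj₂)) bump)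

module Descent {n : ℕ} (v : Perm n) (l : Letter n) where

  ℓ-descent : v (hi l) F.< v (lo l) → suc (ℓ (v ∘P s l)) ≡ ℓ v
  ℓ-descent desc = sym (begin
    ℓ v                                                   ≡⟨ ℓ-as-sum v ⟩
    sum (λ x → sum (inversion v x))                       ≡⟨ sum²-bump shifted (inversion v) (lo l) (hi l) agree bump ⟩
    suc (sum (λ x → sum (shifted x)))                     ≡⟨ cong suc (ℓ-reindex (v ∘P s l) (s l) (s l) (s-involutive l) (s-involutive l)) ⟨
    suc (ℓ (v ∘P s l))                                    ∎)
    where
    open ≡-Reasoning
    shifted : Fin n → Fin n → ℕ
    shifted x y = inversion (v ∘P s l) (s l x) (s l y)
    v∘s∘s : ∀ z → v (s l (s l z)) ≡ v z
    v∘s∘s z = cong v (s-involutive l z)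
    bump : inversion v (lo l) (hi l) ≡ suc (shifted (lo l) (hi l))
    bump = trans (iverson-yes (lo<hi l , desc) (isInversion? v (lo l) (hi l)))
                 (cong suc (sym (iverson-no not-shifted (isInversion? (v ∘P s l) (s l (lo l)) (s l (hi l))))))
      where
      not-shifted : ¬ IsInversion (v ∘P s l) (s l (lo l)) (s l (hi l))
      not-shifted (p , _) = ℕP.<-asym (subst₂ F._<_ (s-lo l) (s-hi l) p) (lo<hi l)
    unaffected : ∀ x y → ¬ (x ≡ lo l × y ≡ hi l) → ¬ (x ≡ hi l × y ≡ lo l) → shifted x y ≡ inversion v x y
    unaffected x y not-lo-hi not-hi-lo = iverson-cong
      (λ (p , q) → s-monotone⁻ l not-hi-lo p , subst₂ F._<_ (v∘s∘s _) (v∘s∘s _) q)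
      (λ (p , q) → s-monotone l not-lo-hi p , subst₂ F._<_ (sym (v∘s∘s _)) (sym (v∘s∘s _)) q)
      (isInversion? (v ∘P s l) (s l x) (s l y)) (isInversion? v x y)
    -- (hi, lo) is an inversion of neither side, since hi > lo and v hi < v lo
    agree-by-cases : ∀ x y → ¬ (x ≡ lo l × y ≡ hi l) → Dec (x ≡ hi l) → Dec (y ≡ lo l) →
                     inversion v x y ≡ shifted x y
    agree-by-cases x y _ (yes refl) (yes refl) = iverson-cong
      (λ (p , _) → ⊥-elim (ℕP.<-asym p (lo<hi l)))
      (λ (_ , q) → ⊥-elim (ℕP.<-asym desc (subst₂ F._<_ (v∘s∘s (lo l)) (v∘s∘s (hi l)) q)))
      (isInversion? v x y) (isInversion? (v ∘P s l) (s l x) (s l y))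
    agree-by-cases x y not-lo-hi (yes _)   (no y≢lo) = sym (unaffected x y not-lo-hi (y≢lo ∘ proj₂))
    agree-by-cases x y not-lo-hi (no x≢hi) _         = sym (unaffected x y not-lo-hi (x≢hi ∘ proj₁))
    agree : ∀ x y → ¬ (x ≡ lo l × y ≡ hi l) → inversion v x y ≡ shifted x y
    agree x y not-lo-hi = agree-by-cases x y not-lo-hi (x FP.≟ hi l) (y FP.≟ lo l)

open Descent using (ℓ-descent)

module _ {n : ℕ} (v : Perm n) (l : Letter n) where

  ℓ-ascent : v (lo l) F.< v (hi l) → ℓ (v ∘P s l) ≡ suc (ℓ v)
  ℓ-ascent asc = begin
    ℓ (v ∘P s l)                     ≡⟨ ℓ-descent (v ∘P s l) l desc ⟨
    suc (ℓ ((v ∘P s l) ∘P s l))      ≡⟨ cong suc (ℓ-cong (λ z → cong v (s-involutive l z))) ⟩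
    suc (ℓ v)                        ∎
    where
    open ≡-Reasoning
    desc : v (s l (hi l)) F.< v (s l (lo l))
    desc = subst₂ F._<_ (cong v (sym (s-hi l))) (cong v (sym (s-lo l))) asc

  s-absorbed : v (lo l) ≡ v (hi l) → (v ∘P s l) ≗P v
  s-absorbed eq z with heightView l z
  ... | at-lo refl    = trans (cong v (s-lo l)) (sym eq)
  ... | at-hi refl    = trans (cong v (s-hi l)) eq
  ... | elsewhere p q = cong v (s-fix l z p q)

  ℓ-right-≤ : ℓ (v ∘P s l) ≤ suc (ℓ v)
  ℓ-right-≤ with FP.<-cmp (v (lo l)) (v (hi l))
  ... | tri< asc _ _  = ℕP.≤-reflexive (ℓ-ascent asc)
  ... | tri≈ _ eq _   = ℕP.≤-trans (ℕP.≤-reflexive (ℓ-cong (s-absorbed eq))) (ℕP.n≤1+n _)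
  ... | tri> _ _ desc = ℕP.≤-trans (ℕP.n≤1+n _) (ℕP.≤-trans (ℕP.≤-reflexive (ℓ-descent v l desc)) (ℕP.n≤1+n _))

-- prod⁻¹ xs inverts prod xs.  Read as a wiring diagram in which every
-- column of xs is a crossing, prod⁻¹ xs h is the left endpoint of the
-- wire ending at height h.
prod⁻¹ : ∀ {n} → List (Letter n) → Perm n
prod⁻¹ []       = idP
prod⁻¹ (x ∷ xs) = prod⁻¹ xs ∘P s x

prod-prod⁻¹ : ∀ {n} (xs : List (Letter n)) h → prod xs (prod⁻¹ xs h) ≡ h
prod-prod⁻¹ []       h = refl
prod-prod⁻¹ (x ∷ xs) h = trans (cong (s x) (prod-prod⁻¹ xs (s x h))) (s-involutive x h)

prod⁻¹-prod : ∀ {n} (xs : List (Letter n)) h → prod⁻¹ xs (prod xs h) ≡ h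
prod⁻¹-prod []       h = refl
prod⁻¹-prod (x ∷ xs) h = trans (cong (prod⁻¹ xs) (s-involutive x (prod xs h))) (prod⁻¹-prod xs h)

ℓ-id : ∀ {n} → ℓ (idP {n}) ≡ 0
ℓ-id {n} = begin
  ℓ (idP {n})                          ≡⟨ ℓ-as-sum (idP {n}) ⟩
  sum (λ x → sum {n} (inversion idP x)) ≡⟨ sum-cong-≗ (λ x → trans (sum-cong-≗ (none x)) (sum-replicate-zero n)) ⟩
  sum {n} (λ _ → 0)                    ≡⟨ sum-replicate-zero n ⟩
  0                                    ∎
  where
  open ≡-Reasoning
  none : ∀ x y → inversion (idP {n}) x y ≡ 0
  none x y = iverson-no (λ (p , q) → ℕP.<-asym p q) (isInversion? idP x y)

ℓ-prod⁻¹-≤ : ∀ {n} (xs : List (Letter n)) → ℓ (prod⁻¹ xs) ≤ length xs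
ℓ-prod⁻¹-≤ {n} []   = ℕP.≤-reflexive (ℓ-id {n})
ℓ-prod⁻¹-≤ (x ∷ xs) = ℕP.≤-trans (ℓ-right-≤ (prod⁻¹ xs) x) (ℕ.s≤s (ℓ-prod⁻¹-≤ xs))

module ReducedTail {n : ℕ} (x : Letter n) (xs : List (Letter n))
                   (reduced : ℓ (prod⁻¹ (x ∷ xs)) ≡ suc (length xs)) where

  private
    v = prod⁻¹ xs

    not-shorter : ¬ (ℓ (v ∘P s x) ≤ ℓ v)
    not-shorter le = ℕP.<-irrefl refl (ℕP.≤-trans (subst (ℕ._≤ ℓ v) reduced le) (ℓ-prod⁻¹-≤ xs))

  reduced-tail-ascent : v (lo x) F.< v (hi x)
  reduced-tail-ascent with FP.<-cmp (v (lo x)) (v (hi x))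
  ... | tri< asc _ _  = asc
  ... | tri≈ _ eq _   = ⊥-elim (not-shorter (ℕP.≤-reflexive (ℓ-cong (s-absorbed v x eq))))
  ... | tri> _ _ desc = ⊥-elim (not-shorter (ℕP.≤-trans (ℕP.n≤1+n _) (ℕP.≤-reflexive (ℓ-descent v x desc))))

  reduced-tail : ℓ v ≡ length xs
  reduced-tail = ℕP.suc-injective (trans (sym (ℓ-ascent v x reduced-tail-ascent)) reduced)

open ReducedTail using (reduced-tail; reduced-tail-ascent)

reduced-drop : ∀ {n} j (xs : List (Letter n)) → ℓ (prod⁻¹ xs) ≡ length xs →
               ℓ (prod⁻¹ (drop j xs)) ≡ length (drop j xs)
reduced-drop zero    xs       r = r
reduced-drop (suc j) []       r = r
reduced-drop (suc j) (x ∷ xs) r = reduced-drop j xs (reduced-tail x xs r)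

drop-lookup : ∀ {A : Set} {m} (ws : Vec A m) (q : Fin m) →
              drop (toℕ q) (toList ws) ≡ V.lookup ws q ∷ drop (suc (toℕ q)) (toList ws)
drop-lookup (w V.∷ ws) F.zero    = refl
drop-lookup (w V.∷ ws) (F.suc q) = drop-lookup ws q

drop-all : ∀ {A : Set} {m} (ws : Vec A m) → drop m (toList ws) ≡ []
drop-all V.[]       = refl
drop-all (w V.∷ ws) = drop-all ws

reduced-ascent : ∀ {n m} (ws : Vec (Letter n) m) → Reduced (toList ws) → (q : Fin m) →
  let x = V.lookup ws q ; v = prod⁻¹ (drop (suc (toℕ q)) (toList ws)) in v (lo x) F.< v (hi x)
reduced-ascent ws reduced q = reduced-tail-ascent (V.lookup ws q) (drop (suc (toℕ q)) (toList ws))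
  (subst (λ xs → ℓ (prod⁻¹ xs) ≡ length xs) (drop-lookup ws q) (reduced-drop (toℕ q) word reduced⁻¹))
  where
  word = toList ws
  reduced⁻¹ : ℓ (prod⁻¹ word) ≡ length word
  reduced⁻¹ = trans (ℓ-inverse (prod⁻¹ word) (prod word) (prod⁻¹-prod word) (prod-prod⁻¹ word)) reduced

ℓ-monotone : ∀ {n} {u w : Perm n} → u ≤B w → ℓ u ≤ ℓ w
ℓ-monotone (≤B-refl u≗w)           = ℕP.≤-reflexive (ℓ-cong u≗w)
ℓ-monotone (≤B-step u≤v _ _ _ v<w) = ℕP.≤-trans (ℓ-monotone u≤v) (ℕP.<⇒≤ v<w)

bruhat-ascent : ∀ {n} (v : Perm n) (l : Letter n) → v <B (v ∘P s l) → v (lo l) F.< v (hi l)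
bruhat-ascent v l (v≤vs , v≉vs) with FP.<-cmp (v (lo l)) (v (hi l))
... | tri< asc _ _  = asc
... | tri≈ _ eq _   = ⊥-elim (v≉vs (λ z → sym (s-absorbed v l eq z)))
... | tri> _ _ desc = ⊥-elim (ℕP.<-irrefl refl
        (ℕP.<-≤-trans (ℕP.≤-reflexive (ℓ-descent v l desc)) (ℓ-monotone v≤vs)))

downward-induction : ∀ {m} (P : ℕ → Set) {j} → P m →
  (∀ (q : Fin m) → j ≤ toℕ q → P (suc (toℕ q)) → P (toℕ q)) → j ≤ m → P j
downward-induction {m} P {j} top step j≤m = go (ℕP.≤⇒≤‴ j≤m) ℕP.≤-refl
  where
  go : ∀ {i} → i ≤‴ m → j ≤ i → P i
  go (≤‴-reflexive refl) _ = top
  go (≤‴-step i<‴m) j≤i with fromℕ< (ℕP.≤″⇒≤ (ℕP.≤‴⇒≤″ i<‴m)) | FP.toℕ-fromℕ< (ℕP.≤″⇒≤ (ℕP.≤‴⇒≤″ i<‴m))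
  ... | q | refl = step q j≤i (go i<‴m (ℕP.m≤n⇒m≤1+n j≤i))

record Oriented {n : ℕ} (R : Rel (Fin n) 0ℓ) (l : Letter n) : Set where
  field
    first second : Fin n
    s-first      : s l first ≡ second
    s-second     : s l second ≡ first
    s-fixes      : ∀ z → z ≢ first → z ≢ second → s l z ≡ z
    ascent       : ∀ (f : Perm n) → f (lo l) F.< f (hi l) → R (f first) (f second)

record Direction (n : ℕ) : Set₁ where
  field
    R        : Rel (Fin n) 0ℓ
    R-trans  : ∀ {x y z} → R x y → R y z → R x z
    R-asym   : ∀ {x y} → R x y → ¬ R y x
    oriented : ∀ l → Oriented R l

downward : ∀ {n} → Direction n
downward = record
  { R        = λ x y → x F.< y
  ; R-trans  = ℕP.<-trans
  ; R-asym   = ℕP.<-asym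
  ; oriented = λ l → record
      { first = lo l ; second = hi l ; s-first = s-lo l ; s-second = s-hi l
      ; s-fixes = s-fix l ; ascent = λ f asc → asc } }

upward : ∀ {n} → Direction n
upward = record
  { R        = λ x y → y F.< x
  ; R-trans  = λ x>y y>z → ℕP.<-trans y>z x>y
  ; R-asym   = ℕP.<-asym
  ; oriented = λ l → record
      { first = hi l ; second = lo l ; s-first = s-hi l ; s-second = s-lo l
      ; s-fixes = λ z z≢hi z≢lo → s-fix l z z≢lo z≢hi ; ascent = λ f asc → asc } }

Separated : ∀ {n} → Direction n → Perm n → Fin n → Set
Separated D u t = ∀ h → R t h → ¬ R (u t) (u h)
  where open Direction D

antiGrassmannian-downward : ∀ {n} k (u : Perm n) t → AntiGrassmannian k u → k ≤ toℕ t → Separated downward u t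
antiGrassmannian-downward k u t (_ , decreasing-after) k≤t h t<h = ℕP.<-asym (decreasing-after t h t<h k≤t)

antiGrassmannian-upward : ∀ {n} k (u : Perm n) t → AntiGrassmannian k u → toℕ t < k → Separated upward u t
antiGrassmannian-upward k u t (decreasing-before , _) t<k h h<t = ℕP.<-asym (decreasing-before h t h<t t<k)

column-partner : ∀ {n} {A : Set} (f : Fin n → A) (l : Letter n) {a b : A} →
  (f (lo l) ≡ a × f (hi l) ≡ b) ⊎ (f (lo l) ≡ b × f (hi l) ≡ a) →
  Σ[ h ∈ Fin n ] f h ≡ a × s l h ≢ h × f (s l h) ≡ b
column-partner f l (inj₁ (lo↦a , hi↦b)) =
  lo l , lo↦a , (λ e → hi≢lo l (trans (sym (s-lo l)) e)) , trans (cong f (s-lo l)) hi↦b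
column-partner f l (inj₂ (lo↦b , hi↦a)) =
  hi l , hi↦a , (λ e → hi≢lo l (trans (sym e) (s-hi l))) , trans (cong f (s-hi l)) lo↦b

subProd-split : ∀ {n} j (xs : List (Letter n)) bs h →
  subProd xs bs h ≡ subProd (take j xs) (take j bs) (subProd (drop j xs) (drop j bs) h)
subProd-split zero    xs       bs           h = refl
subProd-split (suc j) []       bs           h = refl
subProd-split (suc j) (x ∷ xs) []           h = sym (subProd-[] (drop j xs) h)
  where
  subProd-[] : ∀ ys h → subProd ys [] h ≡ h
  subProd-[] []      h = refl
  subProd-[] (_ ∷ _) h = refl
subProd-split (suc j) (x ∷ xs) (true ∷ bs)  h = cong (s x) (subProd-split j xs bs h)
subProd-split (suc j) (x ∷ xs) (false ∷ bs) h = subProd-split j xs bs h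

module BridgeDiagram {n m : ℕ} (ws : Vec (Letter n) m) (J : Vec Bool m) where

  word : List (Letter n)
  word = toList ws

  bits : List Bool
  bits = toList J

  u : Perm n
  u = subProd word bits

  -- leftEnd j h: left endpoint of the wire at height h once the columns of
  -- positions ≥ j have been crossed (so leftEndAt q = leftEnd (suc q)).
  leftEnd : ℕ → Perm n
  leftEnd j = leftEnds ws J (drop j word) (drop j bits)

  wireEnd : ℕ → Perm n
  wireEnd j = prod⁻¹ (drop j word)

  leftEnds-subProd : ∀ xs bs h → leftEnds ws J xs bs (subProd xs bs h) ≡ h
  leftEnds-subProd []       bs           h = refl
  leftEnds-subProd (x ∷ xs) []           h = refl
  leftEnds-subProd (x ∷ xs) (true ∷ bs)  h =
    trans (cong (leftEnds ws J xs bs) (s-involutive x _)) (leftEnds-subProd xs bs h)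
  leftEnds-subProd (x ∷ xs) (false ∷ bs) h = leftEnds-subProd xs bs h

  subProd-leftEnds : ∀ xs bs h → subProd xs bs (leftEnds ws J xs bs h) ≡ h
  subProd-leftEnds []       bs           h = refl
  subProd-leftEnds (x ∷ xs) []           h = refl
  subProd-leftEnds (x ∷ xs) (true ∷ bs)  h =
    trans (cong (s x) (subProd-leftEnds xs bs (s x h))) (s-involutive x h)
  subProd-leftEnds (x ∷ xs) (false ∷ bs) h = subProd-leftEnds xs bs h

  u-injective : ∀ {y z} → u y ≡ u z → y ≡ z
  u-injective {y} {z} uy≡uz = begin
    y                              ≡⟨ leftEnds-subProd word bits y ⟨
    leftEnds ws J word bits (u y)  ≡⟨ cong (leftEnds ws J word bits) uy≡uz ⟩
    leftEnds ws J word bits (u z)  ≡⟨ leftEnds-subProd word bits z ⟩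
    z                              ∎
    where open ≡-Reasoning

  label-leftEnd : ∀ j h → u (leftEnd j h) ≡ uPre ws J j h
  label-leftEnd j h = begin
    u (leftEnd j h)
      ≡⟨ subProd-split j word bits (leftEnd j h) ⟩
    subProd (take j word) (take j bits) (subProd (drop j word) (drop j bits) (leftEnd j h))
      ≡⟨ cong (subProd (take j word) (take j bits)) (subProd-leftEnds (drop j word) (drop j bits) h) ⟩
    uPre ws J j h ∎
    where open ≡-Reasoning

  module Column (q : Fin m) where

    letter : Letter n
    letter = V.lookup ws q

    bit : Bool
    bit = V.lookup J q

    later : List (Letter n)
    later = drop (suc (toℕ q)) word

    laterBits : List Bool
    laterBits = drop (suc (toℕ q)) bits

    leftEnd-column : leftEnd (toℕ q) ≡ leftEnds ws J (letter ∷ later) (bit ∷ laterBits)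
    leftEnd-column = cong₂ (leftEnds ws J) (drop-lookup ws q) (drop-lookup J q)

    leftEnd-bridge : bit ≡ false → ∀ h → leftEnd (toℕ q) h ≡ leftEnd (suc (toℕ q)) h
    leftEnd-bridge bridge h = trans (cong (λ E → E h) leftEnd-column)
                                    (cong (λ b → leftEnds ws J (letter ∷ later) (b ∷ laterBits) h) bridge)

    wireEnd-column : wireEnd (toℕ q) ≡ wireEnd (suc (toℕ q)) ∘P s letter
    wireEnd-column = cong prod⁻¹ (drop-lookup ws q)

    bridge-ascent : IsPDS ws J → bit ≡ false →
      u (leftEnd (suc (toℕ q)) (lo letter)) F.< u (leftEnd (suc (toℕ q)) (hi letter))
    bridge-ascent pds bridge = subst₂ F._<_ (labels (lo letter)) (labels (hi letter))
                                      (bruhat-ascent (uPre ws J (toℕ q)) letter (proj₂ (pds q)))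
      where
      labels : ∀ h → uPre ws J (toℕ q) h ≡ u (leftEnd (suc (toℕ q)) h)
      labels h = trans (sym (label-leftEnd (toℕ q) h)) (cong u (leftEnd-bridge bridge h))

  open Column

  module Tracking (D : Direction n) (a t : Fin n) (ut≡a : u t ≡ a) where

    open Direction D

    -- The invariant left of the leftmost bridge on wire a, for the current
    -- left endpoints E and those W of the wiring diagram of w:
    -- every wire which the wiring diagram places beyond t carries a label
    -- not beyond a, and wire a runs where the wiring diagram runs the wire
    -- from t.
    Tracks : Perm n → Perm n → Set
    Tracks E W = (∀ h → R t (W h) → ¬ R a (u (E h))) × (∀ h → E h ≡ t → W h ≡ t)

    Ascending : Letter n → Perm n → Perm n → Set
    Ascending l E W = u (E (lo l)) F.< u (E (hi l)) × W (lo l) F.< W (hi l)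

    crossing-step : ∀ {l E W} → Tracks E W → Tracks (E ∘P s l) (W ∘P s l)
    crossing-step {l} (beyond , on-track) = beyond ∘ s l , on-track ∘ s l

    bridge-step : ∀ {l E W} → Ascending l E W → E (lo l) ≢ t → E (hi l) ≢ t →
                  Tracks E W → Tracks E (W ∘P s l)
    bridge-step {l} {E} {W} (labels↑ , wires↑) lo≢t hi≢t (beyond , on-track) = beyond′ , on-track′
      where
      open Oriented (oriented l)
      beyond-cases : ∀ h → Dec (h ≡ first) → Dec (h ≡ second) → R t (W (s l h)) → ¬ R a (u (E h))
      beyond-cases h (yes refl) _ t→W a→uE =
        beyond second (subst (R t ∘ W) s-first t→W) (R-trans a→uE (ascent (u ∘ E) labels↑))
      beyond-cases h (no _) (yes refl) t→W =
        beyond second (R-trans (subst (R t ∘ W) s-second t→W) (ascent W wires↑))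
      beyond-cases h (no h≢first) (no h≢second) t→W =
        beyond h (subst (R t ∘ W) (s-fixes h h≢first h≢second) t→W)
      beyond′ : ∀ h → R t (W (s l h)) → ¬ R a (u (E h))
      beyond′ h = beyond-cases h (h FP.≟ first) (h FP.≟ second)
      on-track′ : ∀ h → E h ≡ t → W (s l h) ≡ t
      on-track′ h Eh≡t with heightView l h
      ... | at-lo refl    = ⊥-elim (lo≢t Eh≡t)
      ... | at-hi refl    = ⊥-elim (hi≢t Eh≡t)
      ... | elsewhere p q = trans (cong W (s-fix l h p q)) (on-track h Eh≡t)

    bridge-partner : ∀ {l E W} → Ascending l E W → Tracks E W →
                     ∀ h → u (E h) ≡ a → s l h ≢ h → ¬ R a (u (E (s l h)))
    bridge-partner {l} {E} {W} (labels↑ , wires↑) (beyond , on-track) h uEh≡a moved =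
      partner-cases (h FP.≟ first) (h FP.≟ second)
      where
      open Oriented (oriented l)
      partner-cases : Dec (h ≡ first) → Dec (h ≡ second) → ¬ R a (u (E (s l h)))
      partner-cases (yes refl) _ = subst (λ z → ¬ R a (u (E z))) (sym s-first)
        (beyond second (subst (λ z → R z (W second)) (on-track first (u-injective (trans uEh≡a (sym ut≡a))))
                              (ascent W wires↑)))
      partner-cases (no _) (yes refl) = subst (λ z → ¬ R a (u (E z))) (sym s-second)
        (R-asym (subst (R (u (E first))) uEh≡a (ascent (u ∘ E) labels↑)))
      partner-cases (no h≢first) (no h≢second) = ⊥-elim (moved (s-fixes h h≢first h≢second))

    module _ (reduced : Reduced word) (pds : IsPDS ws J) where

      ascending : ∀ q → bit q ≡ false → Ascending (letter q) (leftEnd (suc (toℕ q))) (wireEnd (suc (toℕ q)))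
      ascending q bridge = bridge-ascent q pds bridge , reduced-ascent ws reduced q

      tracks-left-of : Separated D u t → ∀ p → (∀ q c → toℕ p < toℕ q → ¬ BridgeAt ws J q a c) →
                       Tracks (leftEnd (suc (toℕ p))) (wireEnd (suc (toℕ p)))
      tracks-left-of separated p leftmost =
        downward-induction (λ j → Tracks (leftEnd j) (wireEnd j)) start column (FP.toℕ<n p)
        where
        start : Tracks (leftEnd m) (wireEnd m)
        start = subst₂ Tracks (sym (cong₂ (leftEnds ws J) (drop-all ws) (drop-all J)))
                              (sym (cong prod⁻¹ (drop-all ws)))
                              ((λ h t→h → subst (λ z → ¬ R z (u h)) ut≡a (separated h t→h)) , (λ h h≡t → h≡t))
        column : ∀ q → suc (toℕ p) ≤ toℕ q → Tracks (leftEnd (suc (toℕ q))) (wireEnd (suc (toℕ q))) →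
                 Tracks (leftEnd (toℕ q)) (wireEnd (toℕ q))
        column q p<q tracks =
          subst₂ Tracks (sym (leftEnd-column q)) (sym (wireEnd-column q)) (by-bit (bit q) refl)
          where
          E = leftEnd (suc (toℕ q))
          avoids-lo : bit q ≡ false → E (lo (letter q)) ≢ t
          avoids-lo bridge e = leftmost q _ p<q (bridge , inj₁ (trans (cong u e) ut≡a , refl))
          avoids-hi : bit q ≡ false → E (hi (letter q)) ≢ t
          avoids-hi bridge e = leftmost q _ p<q (bridge , inj₂ (refl , trans (cong u e) ut≡a))
          by-bit : ∀ b → bit q ≡ b → Tracks (leftEnds ws J (letter q ∷ later q) (b ∷ laterBits q))
                                          (wireEnd (suc (toℕ q)) ∘P s (letter q))
          by-bit true  _      = crossing-step {letter q} tracks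
          by-bit false bridge =
            bridge-step {letter q} (ascending q bridge) (avoids-lo bridge) (avoids-hi bridge) tracks

      leftmost-partner : Separated D u t → ∀ b p → LeftmostBridge ws J p a b → ¬ R a b
      leftmost-partner separated b p ((bridge , sides) , leftmost)
        with column-partner (u ∘ leftEnd (suc (toℕ p))) (letter p) sides
      ... | h , uEh≡a , moved , partner≡b =
        subst (λ z → ¬ R a z) partner≡b
              (bridge-partner {letter p} (ascending p bridge) (tracks-left-of separated p leftmost) h uEh≡a moved)

lemma3p5 : ∀ {n m : ℕ} (k : ℕ) → k ≤ n →
  (ws : Vec (Letter n) m) (J : Vec Bool m) →
  Reduced (toList ws) →
  IsPDS ws J →
  AntiGrassmannian k (subProd (toList ws) (toList J)) →
  ∀ (a t b : Fin n) (p : Fin m) →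
  subProd (toList ws) (toList J) t ≡ a →
  LeftmostBridge ws J p a b →
  (a F.< b → toℕ t < k) × (b F.< a → k ≤ toℕ t)
lemma3p5 k _ ws J reduced pds antiGrassmannian a t b p ut≡a leftmostBridge = in-k , outside-k
  where
  open BridgeDiagram ws J
  not-beyond : (D : Direction _) → Separated D u t → ¬ Direction.R D a b
  not-beyond D separated = Tracking.leftmost-partner D a t ut≡a reduced pds separated b p leftmostBridge
  in-k : a F.< b → toℕ t < k
  in-k a<b = ℕP.≰⇒> λ k≤t → not-beyond downward (antiGrassmannian-downward k u t antiGrassmannian k≤t) a<b
  outside-k : b F.< a → k ≤ toℕ t
  outside-k b<a = ℕP.≮⇒≥ λ t<k → not-beyond upward (antiGrassmannian-upward k u t antiGrassmannian t<k) b<a
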